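{- Let $\Gamma,\Delta$ be finite sequences of formulae and $A$ a formula, and let $\Pi_{\Gamma,\Delta}$ be some permutation of the sequence $\Gamma,\Delta$. If $\Pi_{\Gamma,\Delta}\vdash A$ is derivable in $\mathcal{S}$ and $\Delta$ is prime to the sequence $\Gamma,A$, then $\Delta\vdash I$ and $\Gamma\vdash A$ are derivable in $\mathcal{S}$.
   Context: System $\mathcal{S}$: formulae are built from an infinite set of propositional letters and a constant $I$ using binary connectives $\otimes$ and $\to$. Sequents are $\Gamma\vdash A$ with $\Gamma$ a finite, possibly empty, sequence of formulae and $A$ a formula. Axioms: $A\vdash A$ and $\vdash I$. Rules: weakening: from $\Gamma\vdash A$ infer $I,\Gamma\vdash A$; interchange: from $\Gamma,A,B,\Delta\vdash C$ infer $\Gamma,B,A,\Delta\vdash C$; cut: from $\Gamma\vdash A$ and $\Delta,A,\Theta\vdash B$ infer $\Delta,\Gamma,\Theta\vdash B$; $(\otimes\vdash)$: from $\Gamma,A,B,\Delta\vdash C$ infer $\Gamma,A\otimes B,\Delta\vdash C$; $(\vdash\otimes)$: from $\Gamma\vdash A$ and $\Delta\vdash B$ infer $\Gamma,\Delta\vdash A\otimes B$; $(\to\vdash)$: from $\Gamma\vdash A$ and $B,\Delta\vdash C$ infer $\Gamma,A\to B,\Delta\vdash C$; $(\vdash\to)$: from $A,\Gamma\vdash B$ infer $\Gamma\vdash A\to B$. A sequence $\Gamma$ is prime to a sequence $\Delta$ if no propositional letter occurs both in a formula of $\Gamma$ and in a formula of $\Delta$. -}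

module Defs where

open import Data.Nat using (ℕ)
open import Data.List using (List; []; _∷_; _++_)
open import Data.Product using (_×_)
open import Data.Empty using (⊥)

data Formula : Set where
  var  : ℕ → Formula
  I    : Formula
  _⊗_  : Formula → Formula → Formula
  _⇒_  : Formula → Formula → Formula

infixr 6 _⊗_
infixr 5 _⇒_
infix 3 _⊢_

data _⊢_ : List Formula → Formula → Set where
  ax      : ∀ {A} → (A ∷ []) ⊢ A
  I-ax    : [] ⊢ I
  weak    : ∀ {Γ A} → Γ ⊢ A → (I ∷ Γ) ⊢ A
  interch : ∀ Γ {A B Δ C} → (Γ ++ A ∷ B ∷ Δ) ⊢ C → (Γ ++ B ∷ A ∷ Δ) ⊢ C
  cut     : ∀ {Γ A} Δ {Θ B} → Γ ⊢ A → (Δ ++ A ∷ Θ) ⊢ B → (Δ ++ Γ ++ Θ) ⊢ B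
  ⊗L      : ∀ Γ {A B Δ C} → (Γ ++ A ∷ B ∷ Δ) ⊢ C → (Γ ++ (A ⊗ B) ∷ Δ) ⊢ C
  ⊗R      : ∀ {Γ Δ A B} → Γ ⊢ A → Δ ⊢ B → (Γ ++ Δ) ⊢ (A ⊗ B)
  ⇒L      : ∀ Γ {A B Δ C} → Γ ⊢ A → (B ∷ Δ) ⊢ C → (Γ ++ (A ⇒ B) ∷ Δ) ⊢ C
  ⇒R      : ∀ {Γ A B} → (A ∷ Γ) ⊢ B → Γ ⊢ (A ⇒ B)

data OccF (p : ℕ) : Formula → Set where
  here : OccF p (var p)
  ⊗l   : ∀ {A B} → OccF p A → OccF p (A ⊗ B)
  ⊗r   : ∀ {A B} → OccF p B → OccF p (A ⊗ B)
  ⇒l   : ∀ {A B} → OccF p A → OccF p (A ⇒ B)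
  ⇒r   : ∀ {A B} → OccF p B → OccF p (A ⇒ B)

data Occ (p : ℕ) : List Formula → Set where
  hd : ∀ {A Γ} → OccF p A → Occ p (A ∷ Γ)
  tl : ∀ {A Γ} → Occ p Γ → Occ p (A ∷ Γ)

Prime : List Formula → List Formula → Set
Prime Γ Δ = ∀ p → Occ p Γ → Occ p Δ → ⊥

{-# OPTIONS --safe #-}
module Submission where

-- Substituting formulae for letters preserves derivability, and a formula all of
-- whose letters are replaced by I becomes derivable from nothing and derives I.
-- Replacing the letters of Δ by I leaves Γ and A untouched, since Δ is prime to
-- Γ, A, and turns every formula of Δ into a derivable one that can be cut away:
-- this gives Γ ⊢ A. Replacing all other letters by I leaves Δ untouched and makes
-- the formulae of Γ derivable and A derive I; cutting both away gives Δ ⊢ I.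

open import Defs
open import Data.Bool using (if_then_else_)
open import Data.List using (List; []; _∷_; _++_; map)
open import Data.List.Properties using (map-++; ++-assoc; ++-identityʳ)
open import Data.List.Relation.Binary.Permutation.Propositional as ↭ using (_↭_)
open import Data.List.Relation.Unary.All using (All; []; _∷_)
open import Data.Nat using (ℕ)
open import Data.Nat.Properties using (_≟_)
open import Data.Product using (_×_; _,_; proj₁; proj₂)
open import Data.Sum using (inj₁; inj₂; [_,_])
open import Relation.Binary.PropositionalEquality using (_≡_; refl; sym; trans; cong; cong₂; subst; subst₂)
open import Relation.Nullary using (Dec; yes; no; does; ¬_; ¬?; _⊎-dec_; map′)
open import Relation.Nullary.Decidable using (dec-true; dec-false)
open import Relation.Unary using (Pred; Decidable)

occF? : ∀ p F → Dec (OccF p F)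
occF? p (var q) with p ≟ q
... | yes refl = yes here
... | no p≢q   = no λ { here → p≢q refl }
occF? p I = no λ ()
occF? p (F ⊗ G) =
  map′ [ ⊗l , ⊗r ] (λ { (⊗l o) → inj₁ o ; (⊗r o) → inj₂ o }) (occF? p F ⊎-dec occF? p G)
occF? p (F ⇒ G) =
  map′ [ ⇒l , ⇒r ] (λ { (⇒l o) → inj₁ o ; (⇒r o) → inj₂ o }) (occF? p F ⊎-dec occF? p G)

occ? : ∀ p Γ → Dec (Occ p Γ)
occ? p []      = no λ ()
occ? p (F ∷ Γ) =
  map′ [ hd , tl ] (λ { (hd o) → inj₁ o ; (tl o) → inj₂ o }) (occF? p F ⊎-dec occ? p Γ)

occ-++ˡ : ∀ {p} Γ {Δ} → Occ p Γ → Occ p (Γ ++ Δ)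
occ-++ˡ (_ ∷ Γ) (hd o) = hd o
occ-++ˡ (_ ∷ Γ) (tl o) = tl (occ-++ˡ Γ o)

occ-++ʳ : ∀ {p} Γ {Δ} → Occ p Δ → Occ p (Γ ++ Δ)
occ-++ʳ []      o = o
occ-++ʳ (_ ∷ Γ) o = tl (occ-++ʳ Γ o)

permute : ∀ Ψ {Γ Γ′ A} → Γ ↭ Γ′ → Ψ ++ Γ ⊢ A → Ψ ++ Γ′ ⊢ A
permute Ψ ↭.refl d = d
permute Ψ (↭.prep F π) d =
  subst (_⊢ _) (++-assoc Ψ (F ∷ []) _)
    (permute (Ψ ++ F ∷ []) π (subst (_⊢ _) (sym (++-assoc Ψ (F ∷ []) _)) d))
permute Ψ (↭.swap F G π) d =
  subst (_⊢ _) (++-assoc Ψ (G ∷ F ∷ []) _)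
    (permute (Ψ ++ G ∷ F ∷ []) π (subst (_⊢ _) (sym (++-assoc Ψ (G ∷ F ∷ []) _)) (interch Ψ d)))
permute Ψ (↭.trans π ρ) d = permute Ψ ρ (permute Ψ π d)

cut-derivables : ∀ Ψ {Δ Θ A} → All ([] ⊢_) Δ → Ψ ++ Δ ++ Θ ⊢ A → Ψ ++ Θ ⊢ A
cut-derivables Ψ []       d = d
cut-derivables Ψ (e ∷ es) d = cut-derivables Ψ es (cut Ψ e d)

Neutral : Formula → Set
Neutral B = ([] ⊢ B) × (B ∷ [] ⊢ I)

sub : (ℕ → Formula) → Formula → Formula
sub σ (var p) = σ p
sub σ I       = I
sub σ (A ⊗ B) = sub σ A ⊗ sub σ B
sub σ (A ⇒ B) = sub σ A ⇒ sub σ B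

module _ (σ : ℕ → Formula) where

  private
    s = sub σ

  sub-⊢ : ∀ {Γ A} → Γ ⊢ A → map s Γ ⊢ s A
  sub-⊢ ax       = ax
  sub-⊢ I-ax     = I-ax
  sub-⊢ (weak d) = weak (sub-⊢ d)
  sub-⊢ (interch Γ {A} {B} {Δ} d) =
    subst (_⊢ _) (sym (map-++ s Γ (B ∷ A ∷ Δ)))
      (interch (map s Γ) (subst (_⊢ _) (map-++ s Γ (A ∷ B ∷ Δ)) (sub-⊢ d)))
  sub-⊢ (cut {Γ} {A} Δ {Θ} d e) =
    subst (_⊢ _) (sym (trans (map-++ s Δ (Γ ++ Θ)) (cong (map s Δ ++_) (map-++ s Γ Θ))))
      (cut (map s Δ) (sub-⊢ d) (subst (_⊢ _) (map-++ s Δ (A ∷ Θ)) (sub-⊢ e)))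
  sub-⊢ (⊗L Γ {A} {B} {Δ} d) =
    subst (_⊢ _) (sym (map-++ s Γ ((A ⊗ B) ∷ Δ)))
      (⊗L (map s Γ) (subst (_⊢ _) (map-++ s Γ (A ∷ B ∷ Δ)) (sub-⊢ d)))
  sub-⊢ (⊗R {Γ} {Δ} d e) = subst (_⊢ _) (sym (map-++ s Γ Δ)) (⊗R (sub-⊢ d) (sub-⊢ e))
  sub-⊢ (⇒L Γ {A} {B} {Δ} d e) =
    subst (_⊢ _) (sym (map-++ s Γ ((A ⇒ B) ∷ Δ))) (⇒L (map s Γ) (sub-⊢ d) (sub-⊢ e))
  sub-⊢ (⇒R d) = ⇒R (sub-⊢ d)

  sub-id : ∀ F → (∀ {p} → OccF p F → σ p ≡ var p) → s F ≡ F
  sub-id (var p) fix = fix here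
  sub-id I       fix = refl
  sub-id (F ⊗ G) fix = cong₂ _⊗_ (sub-id F (λ o → fix (⊗l o))) (sub-id G (λ o → fix (⊗r o)))
  sub-id (F ⇒ G) fix = cong₂ _⇒_ (sub-id F (λ o → fix (⇒l o))) (sub-id G (λ o → fix (⇒r o)))

  map-sub-id : ∀ Γ → (∀ {p} → Occ p Γ → σ p ≡ var p) → map s Γ ≡ Γ
  map-sub-id []      fix = refl
  map-sub-id (F ∷ Γ) fix = cong₂ _∷_ (sub-id F (λ o → fix (hd o))) (map-sub-id Γ (λ o → fix (tl o)))

  sub-neutral : ∀ F → (∀ {p} → OccF p F → σ p ≡ I) → Neutral (s F)
  sub-neutral (var p) kill rewrite kill here = I-ax , weak I-ax
  sub-neutral I       kill = I-ax , weak I-ax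
  sub-neutral (F ⊗ G) kill with sub-neutral F (λ o → kill (⊗l o)) | sub-neutral G (λ o → kill (⊗r o))
  ... | ⊢F , F⊢I | ⊢G , G⊢I = ⊗R ⊢F ⊢G , ⊗L [] (cut [] F⊢I (weak G⊢I))
  sub-neutral (F ⇒ G) kill with sub-neutral F (λ o → kill (⇒l o)) | sub-neutral G (λ o → kill (⇒r o))
  ... | ⊢F , F⊢I | ⊢G , G⊢I = ⇒R (cut [] F⊢I (weak ⊢G)) , ⇒L [] ⊢F G⊢I

  map-sub-derivable : ∀ Γ → (∀ {p} → Occ p Γ → σ p ≡ I) → All ([] ⊢_) (map s Γ)
  map-sub-derivable []      kill = []
  map-sub-derivable (F ∷ Γ) kill =
    proj₁ (sub-neutral F (λ o → kill (hd o))) ∷ map-sub-derivable Γ (λ o → kill (tl o))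

  erase-right : ∀ Γ Δ {A} →
                (∀ {p} → Occ p Γ → σ p ≡ var p) → (∀ {p} → OccF p A → σ p ≡ var p) →
                (∀ {p} → Occ p Δ → σ p ≡ I) → Γ ++ Δ ⊢ A → Γ ⊢ A
  erase-right Γ Δ {A} fixΓ fixA killΔ d =
    subst (_⊢ A) (++-identityʳ Γ)
      (cut-derivables Γ (map-sub-derivable Δ killΔ) (subst₂ _⊢_ ctx (sub-id A fixA) (sub-⊢ d)))
    where
      ctx : map s (Γ ++ Δ) ≡ Γ ++ map s Δ ++ []
      ctx = trans (map-++ s Γ Δ)
              (cong₂ _++_ (map-sub-id Γ fixΓ) (sym (++-identityʳ (map s Δ))))

  isolate-right : ∀ Γ Δ {A} →
                  (∀ {p} → Occ p Γ → σ p ≡ I) → (∀ {p} → OccF p A → σ p ≡ I) →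
                  (∀ {p} → Occ p Δ → σ p ≡ var p) → Γ ++ Δ ⊢ A → Δ ⊢ I
  isolate-right Γ Δ {A} killΓ killA fixΔ d =
    subst (_⊢ I) (++-identityʳ Δ) (cut [] {[]} Δ⊢sA (proj₂ (sub-neutral A killA)))
    where
      Δ⊢sA : Δ ⊢ s A
      Δ⊢sA = cut-derivables [] (map-sub-derivable Γ killΓ)
               (subst (_⊢ s A) (trans (map-++ s Γ Δ) (cong (map s Γ ++_) (map-sub-id Δ fixΔ)))
                 (sub-⊢ d))

collapse : ∀ {ℓ} {P : Pred ℕ ℓ} → Decidable P → ℕ → Formula
collapse P? p = if does (P? p) then I else var p

module _ {ℓ} {P : Pred ℕ ℓ} (P? : Decidable P) where

  collapse-∈ : ∀ {p} → P p → collapse P? p ≡ I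
  collapse-∈ {p} Pp rewrite dec-true (P? p) Pp = refl

  collapse-∉ : ∀ {p} → ¬ P p → collapse P? p ≡ var p
  collapse-∉ {p} ¬Pp rewrite dec-false (P? p) ¬Pp = refl

lemma3p3 : (Γ Δ Π : List Formula) (A : Formula) → Π ↭ (Γ ++ Δ) → Π ⊢ A → Prime Δ (Γ ++ A ∷ []) → (Δ ⊢ I) × (Γ ⊢ A)
lemma3p3 Γ Δ Π A π d prime =
  isolate-right (collapse outsideΔ?) Γ Δ
    (λ o → collapse-∈ outsideΔ? (Γ-free o)) (λ o → collapse-∈ outsideΔ? (A-free o))
    (λ o → collapse-∉ outsideΔ? λ ∉Δ → ∉Δ o) ΓΔ⊢A ,
  erase-right (collapse insideΔ?) Γ Δ
    (λ o → collapse-∉ insideΔ? (Γ-free o)) (λ o → collapse-∉ insideΔ? (A-free o))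
    (collapse-∈ insideΔ?) ΓΔ⊢A
  where
    ΓΔ⊢A : Γ ++ Δ ⊢ A
    ΓΔ⊢A = permute [] π d

    Γ-free : ∀ {p} → Occ p Γ → ¬ Occ p Δ
    Γ-free o o′ = prime _ o′ (occ-++ˡ Γ o)

    A-free : ∀ {p} → OccF p A → ¬ Occ p Δ
    A-free o o′ = prime _ o′ (occ-++ʳ Γ (hd o))

    insideΔ? : Decidable (λ p → Occ p Δ)
    insideΔ? p = occ? p Δ

    outsideΔ? : Decidable (λ p → ¬ Occ p Δ)
    outsideΔ? p = ¬? (occ? p Δ)
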